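{- For every graph $G$ without isolated vertices, $\gamma_{\times 2}(G)\le 2\gamma_2(G)-1$.
   Context: $G=(V,E)$ finite simple graph; $N(v)$, $N[v]$ open and closed neighborhoods. $\gamma_2(G)$ is the minimum size of a set $D\subseteq V$ such that every vertex not in $D$ has at least two neighbors in $D$. $\gamma_{\times 2}(G)$ is the minimum size of a set $D\subseteq V$ such that $|N[v]\cap D|\ge 2$ for every $v\in V$. -}

module Defs where

open import Data.Nat using (ℕ; _≤_; _+_)
open import Data.Fin using (Fin)
open import Data.Fin.Subset using (Subset; _∈_; _∉_; ∣_∣)
open import Data.Product using (Σ; ∃; _×_; _,_)
open import Data.Empty using (⊥)
open import Relation.Nullary using (¬_)
open import Relation.Binary.PropositionalEquality using (_≡_)

record Graph (n : ℕ) : Set₁ where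
  field
    Adj     : Fin n → Fin n → Set
    irrefl  : ∀ v → ¬ Adj v v
    sym     : ∀ {u v} → Adj u v → Adj v u

open Graph public

NoIsolated : ∀ {n} → Graph n → Set
NoIsolated {n} G = ∀ v → ∃ λ u → Adj G v u

TwoNbrsIn : ∀ {n} → Graph n → Subset n → Fin n → Set
TwoNbrsIn G D v =
  ∃ λ u → ∃ λ w → ¬ (u ≡ w) × Adj G v u × Adj G v w × u ∈ D × w ∈ D

NbrIn : ∀ {n} → Graph n → Subset n → Fin n → Set
NbrIn G D v = ∃ λ u → Adj G v u × u ∈ D

Is2Dominating : ∀ {n} → Graph n → Subset n → Set
Is2Dominating G D = ∀ v → v ∉ D → TwoNbrsIn G D v

-- double dominating set: |N[v] ∩ D| ≥ 2 for every v.
-- Written out: if v ∈ D then v has a neighbour in D; otherwise v has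
-- two distinct neighbours in D.
IsDoubleDominating : ∀ {n} → Graph n → Subset n → Set
IsDoubleDominating G D =
  ∀ v → (v ∈ D → NbrIn G D v) × (v ∉ D → TwoNbrsIn G D v)

IsMinSize : ∀ {n} → (Subset n → Set) → ℕ → Set
IsMinSize {n} P k = (∃ λ D → P D × ∣ D ∣ ≡ k) × (∀ D → P D → k ≤ ∣ D ∣)

IsGamma2 : ∀ {n} → Graph n → ℕ → Set
IsGamma2 G = IsMinSize (Is2Dominating G)

IsGammaX2 : ∀ {n} → Graph n → ℕ → Set
IsGammaX2 G = IsMinSize (IsDoubleDominating G)

module Submission where

-- Fix a choice  f v  of a neighbour for every vertex.  A superset B of a
-- 2-dominating set D is double dominating as soon as every vertex of D has a
-- neighbour in B (a vertex outside B is outside D, hence has two neighbours in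
-- D ⊆ B).  So D ∪ f(D) works, but may be one vertex too large.  The saving
-- comes from a *patch*: sets X and C ⊆ D with |X| < |C| such that every vertex
-- of C already has a neighbour in D ∪ X; then
--     D' = (D ∪ X) ∪ f(D ∖ C)
-- is double dominating and |D'| ≤ |D| + |X| + (|D| - |C|) ≤ 2|D| - 1.
-- A patch exists whenever D is nonempty: take v₀ ∈ D and u = f v₀.  If u ∈ D,
-- use X = ∅, C = {v₀}; otherwise u has two distinct neighbours w₁, w₂ in D and
-- use X = {u}, C = {w₁, w₂}.

open import Defs
open import Data.Nat using (_≤_; _*_; _∸_; suc; _+_; s≤s; z≤n)
open import Data.Nat.Properties
  using (≤-trans; n≤1+n; +-mono-≤; +-assoc; +-comm; +-suc; +-identityʳ; +-monoˡ-≤; +-monoʳ-≤; ∸-monoˡ-≤; module ≤-Reasoning)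
open import Data.Fin using (Fin) renaming (zero to fzero; suc to fsuc)
open import Data.Fin.Subset
  using (Subset; ∣_∣; _∈_; _∉_; _∪_; _∩_; _─_; ⁅_⁆; _⊆_; _⊂_; inside; outside; ⊥)
open import Data.Fin.Subset.Properties
  using (_∈?_; x∈⁅x⁆; x∈⁅y⁆⇒x≡y; ∣⁅x⁆∣≡1; ∣⊥∣≡0; x∈p∪q⁺; x∈p∪q⁻; x≢y⇒x∉⁅y⁆;
         p⊆p∪q; q⊆p∪q; x∈p∩q⁺; x∈p∧x∉q⇒x∈p─q; p⊆q⇒∣p∣≤∣q∣; p⊂q⇒∣p∣<∣q∣)
open import Data.Vec using ([]; _∷_; here; there)
open import Data.Product using (Σ; ∃; _×_; _,_; proj₁; proj₂)
open import Data.Sum using (inj₁; inj₂; [_,_])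
open import Relation.Nullary using (¬_; yes; no)
open import Relation.Binary.PropositionalEquality
  using (_≡_; refl; subst; subst₂; cong; trans) renaming (sym to ≡-sym)
open import Function using (_∘_)

∣p∪q∣≤∣p∣+∣q∣ : ∀ {n} (p q : Subset n) → ∣ p ∪ q ∣ ≤ ∣ p ∣ + ∣ q ∣
∣p∪q∣≤∣p∣+∣q∣ []            []            = z≤n
∣p∪q∣≤∣p∣+∣q∣ (inside  ∷ p) (outside ∷ q) = s≤s (∣p∪q∣≤∣p∣+∣q∣ p q)
∣p∪q∣≤∣p∣+∣q∣ (inside  ∷ p) (inside  ∷ q) =
  s≤s (≤-trans (∣p∪q∣≤∣p∣+∣q∣ p q) (+-monoʳ-≤ ∣ p ∣ (n≤1+n ∣ q ∣)))
∣p∪q∣≤∣p∣+∣q∣ (outside ∷ p) (outside ∷ q) = ∣p∪q∣≤∣p∣+∣q∣ p q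
∣p∪q∣≤∣p∣+∣q∣ (outside ∷ p) (inside  ∷ q) =
  subst (suc ∣ p ∪ q ∣ ≤_) (≡-sym (+-suc ∣ p ∣ ∣ q ∣)) (s≤s (∣p∪q∣≤∣p∣+∣q∣ p q))

∣p─q∣+∣p∩q∣≡∣p∣ : ∀ {n} (p q : Subset n) → ∣ p ─ q ∣ + ∣ p ∩ q ∣ ≡ ∣ p ∣
∣p─q∣+∣p∩q∣≡∣p∣ []            []            = refl
∣p─q∣+∣p∩q∣≡∣p∣ (outside ∷ p) (outside ∷ q) = ∣p─q∣+∣p∩q∣≡∣p∣ p q
∣p─q∣+∣p∩q∣≡∣p∣ (outside ∷ p) (inside  ∷ q) = ∣p─q∣+∣p∩q∣≡∣p∣ p q
∣p─q∣+∣p∩q∣≡∣p∣ (inside  ∷ p) (outside ∷ q) = cong suc (∣p─q∣+∣p∩q∣≡∣p∣ p q)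
∣p─q∣+∣p∩q∣≡∣p∣ (inside  ∷ p) (inside  ∷ q) =
  trans (+-suc ∣ p ─ q ∣ ∣ p ∩ q ∣) (cong suc (∣p─q∣+∣p∩q∣≡∣p∣ p q))

∣p─q∣+∣q∣≤∣p∣ : ∀ {n} (p q : Subset n) → q ⊆ p → ∣ p ─ q ∣ + ∣ q ∣ ≤ ∣ p ∣
∣p─q∣+∣q∣≤∣p∣ p q q⊆p = begin
  ∣ p ─ q ∣ + ∣ q ∣      ≤⟨ +-monoʳ-≤ ∣ p ─ q ∣ (p⊆q⇒∣p∣≤∣q∣ (λ x∈q → x∈p∩q⁺ (q⊆p x∈q , x∈q))) ⟩
  ∣ p ─ q ∣ + ∣ p ∩ q ∣  ≡⟨ ∣p─q∣+∣p∩q∣≡∣p∣ p q ⟩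
  ∣ p ∣                  ∎
  where open ≤-Reasoning

2≤∣⁅x⁆∪⁅y⁆∣ : ∀ {n} {x y : Fin n} → ¬ x ≡ y → 2 ≤ ∣ ⁅ x ⁆ ∪ ⁅ y ⁆ ∣
2≤∣⁅x⁆∪⁅y⁆∣ {x = x} {y} x≢y =
  subst (λ k → suc k ≤ ∣ ⁅ x ⁆ ∪ ⁅ y ⁆ ∣) (∣⁅x⁆∣≡1 y) (p⊂q⇒∣p∣<∣q∣ ⁅y⁆⊂⁅x⁆∪⁅y⁆)
  where
    ⁅y⁆⊂⁅x⁆∪⁅y⁆ : ⁅ y ⁆ ⊂ ⁅ x ⁆ ∪ ⁅ y ⁆
    ⁅y⁆⊂⁅x⁆∪⁅y⁆ = q⊆p∪q ⁅ x ⁆ ⁅ y ⁆ , x , x∈p∪q⁺ (inj₁ (x∈⁅x⁆ x)) , x≢y⇒x∉⁅y⁆ x≢y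

image : ∀ {m n} → (Fin m → Fin n) → Subset m → Subset n
image f []            = ⊥
image f (outside ∷ p) = image (f ∘ fsuc) p
image f (inside  ∷ p) = ⁅ f fzero ⁆ ∪ image (f ∘ fsuc) p

∈-image : ∀ {m n} (f : Fin m → Fin n) (S : Subset m) {x} → x ∈ S → f x ∈ image f S
∈-image f (inside  ∷ p) here      = x∈p∪q⁺ (inj₁ (x∈⁅x⁆ (f fzero)))
∈-image f (inside  ∷ p) (there i) = x∈p∪q⁺ (inj₂ (∈-image (f ∘ fsuc) p i))
∈-image f (outside ∷ p) (there i) = ∈-image (f ∘ fsuc) p i

∣image∣≤ : ∀ {m n} (f : Fin m → Fin n) (S : Subset m) → ∣ image f S ∣ ≤ ∣ S ∣
∣image∣≤ {n = n} f [] = subst (_≤ 0) (≡-sym (∣⊥∣≡0 n)) z≤n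
∣image∣≤ f (outside ∷ p) = ∣image∣≤ (f ∘ fsuc) p
∣image∣≤ f (inside  ∷ p) = begin
  ∣ ⁅ f fzero ⁆ ∪ image (f ∘ fsuc) p ∣      ≤⟨ ∣p∪q∣≤∣p∣+∣q∣ ⁅ f fzero ⁆ (image (f ∘ fsuc) p) ⟩
  ∣ ⁅ f fzero ⁆ ∣ + ∣ image (f ∘ fsuc) p ∣  ≡⟨ cong (_+ ∣ image (f ∘ fsuc) p ∣) (∣⁅x⁆∣≡1 (f fzero)) ⟩
  suc ∣ image (f ∘ fsuc) p ∣                ≤⟨ s≤s (∣image∣≤ (f ∘ fsuc) p) ⟩
  suc ∣ p ∣                                 ∎
  where open ≤-Reasoning

⁅x⁆⊆ : ∀ {n} {x : Fin n} {p : Subset n} → x ∈ p → ⁅ x ⁆ ⊆ p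
⁅x⁆⊆ {x = x} x∈p y∈⁅x⁆ = subst (_∈ _) (≡-sym (x∈⁅y⁆⇒x≡y x y∈⁅x⁆)) x∈p

module _ {n} (G : Graph n) where

  doubleDominating-extension : ∀ {D B} → Is2Dominating G D → D ⊆ B →
    (∀ {v} → v ∈ D → NbrIn G B v) → IsDoubleDominating G B
  doubleDominating-extension {D} {B} isD D⊆B cover v = inB , notInB
    where
      inB : v ∈ B → NbrIn G B v
      inB _ with v ∈? D
      ... | yes v∈D = cover v∈D
      ... | no  v∉D = let (u , _ , _ , v~u , _ , u∈D , _) = isD v v∉D in u , v~u , D⊆B u∈D

      notInB : v ∉ B → TwoNbrsIn G B v
      notInB v∉B =
        let (u , w , u≢w , v~u , v~w , u∈D , w∈D) = isD v (v∉B ∘ D⊆B)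
        in u , w , u≢w , v~u , v~w , D⊆B u∈D , D⊆B w∈D

  record Patch (D : Subset n) : Set where
    field
      X C     : Subset n
      C⊆D     : C ⊆ D
      covered : ∀ {v} → v ∈ C → NbrIn G (D ∪ X) v
      smaller : suc ∣ X ∣ ≤ ∣ C ∣

  patch-inside : ∀ {D v₀ u} → v₀ ∈ D → Adj G v₀ u → u ∈ D → Patch D
  patch-inside {D} {v₀} {u} v₀∈D v₀~u u∈D = record
    { X = ⊥ ; C = ⁅ v₀ ⁆ ; C⊆D = ⁅x⁆⊆ v₀∈D
    ; covered = λ v∈⁅v₀⁆ → subst (NbrIn G (D ∪ ⊥)) (≡-sym (x∈⁅y⁆⇒x≡y v₀ v∈⁅v₀⁆))
                                 (u , v₀~u , p⊆p∪q ⊥ u∈D)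
    ; smaller = subst₂ _≤_ (≡-sym (cong suc (∣⊥∣≡0 n))) (≡-sym (∣⁅x⁆∣≡1 v₀)) (s≤s z≤n) }

  patch-outside : ∀ {D u} → TwoNbrsIn G D u → Patch D
  patch-outside {D} {u} (w₁ , w₂ , w₁≢w₂ , u~w₁ , u~w₂ , w₁∈D , w₂∈D) = record
    { X = ⁅ u ⁆ ; C = ⁅ w₁ ⁆ ∪ ⁅ w₂ ⁆
    ; C⊆D = λ v∈C → [ ⁅x⁆⊆ w₁∈D , ⁅x⁆⊆ w₂∈D ] (x∈p∪q⁻ ⁅ w₁ ⁆ ⁅ w₂ ⁆ v∈C)
    ; covered = λ v∈C → [ coveredBy u~w₁ , coveredBy u~w₂ ] (x∈p∪q⁻ ⁅ w₁ ⁆ ⁅ w₂ ⁆ v∈C)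
    ; smaller = subst (_≤ ∣ ⁅ w₁ ⁆ ∪ ⁅ w₂ ⁆ ∣) (≡-sym (cong suc (∣⁅x⁆∣≡1 u))) (2≤∣⁅x⁆∪⁅y⁆∣ w₁≢w₂) }
    where
      coveredBy : ∀ {w} → Adj G u w → ∀ {v} → v ∈ ⁅ w ⁆ → NbrIn G (D ∪ ⁅ u ⁆) v
      coveredBy u~w v∈⁅w⁆ = subst (NbrIn G (D ∪ ⁅ u ⁆)) (≡-sym (x∈⁅y⁆⇒x≡y _ v∈⁅w⁆))
                                  (u , Graph.sym G u~w , q⊆p∪q D ⁅ u ⁆ (x∈⁅x⁆ u))

  patch : NoIsolated G → ∀ {D} → Is2Dominating G D → ∀ {v₀} → v₀ ∈ D → Patch D
  patch noIso {D} isD {v₀} v₀∈D with noIso v₀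
  ... | u , v₀~u with u ∈? D
  ...   | yes u∈D = patch-inside v₀∈D v₀~u u∈D
  ...   | no  u∉D = patch-outside (isD u u∉D)

  patched : (noIso : NoIsolated G) → ∀ {D} → Is2Dominating G D → Patch D →
    Σ (Subset n) λ D' → IsDoubleDominating G D' × suc ∣ D' ∣ ≤ ∣ D ∣ + ∣ D ∣
  patched noIso {D} isD P = D' , doubleDominating-extension isD D⊆D' cover , size
    where
      open Patch P

      f : Fin n → Fin n
      f v = proj₁ (noIso v)

      D' : Subset n
      D' = (D ∪ X) ∪ image f (D ─ C)

      D∪X⊆D' : D ∪ X ⊆ D'
      D∪X⊆D' = p⊆p∪q (image f (D ─ C))

      D⊆D' : D ⊆ D'
      D⊆D' = D∪X⊆D' ∘ p⊆p∪q X

      cover : ∀ {v} → v ∈ D → NbrIn G D' v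
      cover {v} v∈D with v ∈? C
      ... | yes v∈C = let (u , v~u , u∈D∪X) = covered v∈C in u , v~u , D∪X⊆D' u∈D∪X
      ... | no  v∉C = f v , proj₂ (noIso v) ,
                      q⊆p∪q (D ∪ X) _ (∈-image f (D ─ C) (x∈p∧x∉q⇒x∈p─q v∈D v∉C))

      size : suc ∣ D' ∣ ≤ ∣ D ∣ + ∣ D ∣
      size = begin
        suc ∣ D' ∣
          ≤⟨ s≤s (∣p∪q∣≤∣p∣+∣q∣ (D ∪ X) (image f (D ─ C))) ⟩
        suc (∣ D ∪ X ∣ + ∣ image f (D ─ C) ∣)
          ≤⟨ s≤s (+-mono-≤ (∣p∪q∣≤∣p∣+∣q∣ D X) (∣image∣≤ f (D ─ C))) ⟩
        suc (∣ D ∣ + ∣ X ∣ + ∣ D ─ C ∣)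
          ≡⟨ cong suc (+-assoc (∣ D ∣) (∣ X ∣) (∣ D ─ C ∣)) ⟩
        suc (∣ D ∣ + (∣ X ∣ + ∣ D ─ C ∣))
          ≡⟨ ≡-sym (+-suc (∣ D ∣) (∣ X ∣ + ∣ D ─ C ∣)) ⟩
        ∣ D ∣ + (suc ∣ X ∣ + ∣ D ─ C ∣)
          ≤⟨ +-monoʳ-≤ ∣ D ∣ (+-monoˡ-≤ (∣ D ─ C ∣) smaller) ⟩
        ∣ D ∣ + (∣ C ∣ + ∣ D ─ C ∣)
          ≡⟨ cong (∣ D ∣ +_) (+-comm (∣ C ∣) (∣ D ─ C ∣)) ⟩
        ∣ D ∣ + (∣ D ─ C ∣ + ∣ C ∣)
          ≤⟨ +-monoʳ-≤ ∣ D ∣ (∣p─q∣+∣q∣≤∣p∣ D C C⊆D) ⟩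
        ∣ D ∣ + ∣ D ∣
          ∎
        where open ≤-Reasoning

  2dominating-nonempty : ∀ {D} → Is2Dominating G D → Fin n → ∃ λ v → v ∈ D
  2dominating-nonempty {D} isD v with v ∈? D
  ... | yes v∈D = v , v∈D
  ... | no  v∉D = let (u , _ , _ , _ , _ , u∈D , _) = isD v v∉D in u , u∈D

<double⇒≤double∸1 : ∀ {x} d → suc x ≤ d + d → x ≤ 2 * d ∸ 1
<double⇒≤double∸1 d x<d+d =
  subst (λ k → _ ≤ d + k ∸ 1) (≡-sym (+-identityʳ d)) (∸-monoˡ-≤ 1 x<d+d)

mainTheorem15 : ∀ {n} (G : Graph n) → NoIsolated G →
    ∀ g2 gx2 → IsGamma2 G g2 → IsGammaX2 G gx2 → gx2 ≤ 2 * g2 ∸ 1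
mainTheorem15 {0}     _ _ _ _ _ (_ , minimal) = ≤-trans (minimal [] (λ ())) z≤n
mainTheorem15 {suc _} G noIso _ gx2 ((D , isD , refl) , _) (_ , minimal) =
  let (v₀ , v₀∈D)            = 2dominating-nonempty G isD fzero
      (D' , isDD , D'<2∣D∣) = patched G noIso isD (patch G noIso isD v₀∈D)
  in ≤-trans (minimal D' isDD) (<double⇒≤double∸1 ∣ D ∣ D'<2∣D∣)
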